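{- Let $G$ be a graph of order $n\geq 5$ such that both $G$ and its complement $\overline{G}$ are connected. Then $rvx_3(G)+rvx_3(\overline{G})\geq 2$. Moreover, the bound is sharp: for every $n\ge 5$ there is such a graph $G$ with $rvx_3(G)+rvx_3(\overline{G})=2$.
   Context: All graphs are finite, simple and undirected. For $S\subseteq V(G)$ with $|S|\ge 2$, an $S$-tree is a subgraph of $G$ that is a tree containing $S$. Given a vertex-coloring of $G$, an $S$-tree $T$ is vertex-rainbow if the vertices of $V(T)\setminus S$ have pairwise distinct colors. A vertex-coloring is a $3$-vertex-rainbow coloring if every $3$-subset $S$ of $V(G)$ has a vertex-rainbow $S$-tree; $rvx_3(G)$ is the minimum number of colors of such a coloring (with $rvx_3(G)=0$ meaning every $3$-subset $S$ has an $S$-tree with vertex set exactly $S$). -}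

module Defs where

open import Data.Nat using (ℕ; zero; suc; _<_; _≤_)
open import Data.Fin using (Fin)
open import Data.Bool using (Bool; true; false; not; _∧_)
open import Data.Bool.Properties using (∧-zeroʳ)
open import Data.List using (List; []; _∷_; _++_; [_]; length)
open import Data.List.Relation.Unary.Linked using (Linked)
open import Data.List.Relation.Unary.Unique.Propositional using (Unique)
open import Data.Product using (Σ; _×_; ∃)
open import Data.Sum using (_⊎_)
open import Data.Empty using (⊥; ⊥-elim)
open import Relation.Nullary using (¬_)
open import Relation.Nullary.Decidable using (⌊_⌋)
open import Relation.Binary.PropositionalEquality using (_≡_; _≢_)
import Data.Fin as F

record Graph (n : ℕ) : Set where
  field
    adj    : Fin n → Fin n → Bool
    adj-sym    : ∀ u v → adj u v ≡ adj v u
    adj-irrefl : ∀ u → adj u u ≡ false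
open Graph public

complement : ∀ {n} → Graph n → Graph n
complement {n} G = record
  { adj = λ u v → not (adj G u v) ∧ not ⌊ u F.≟ v ⌋
  ; adj-sym = symc
  ; adj-irrefl = irc }
  where
  open import Relation.Binary.PropositionalEquality using (refl; sym; cong₂; cong)
  open import Relation.Nullary using (yes; no)
  symc : ∀ u v → (not (adj G u v) ∧ not ⌊ u F.≟ v ⌋) ≡ (not (adj G v u) ∧ not ⌊ v F.≟ u ⌋)
  symc u v with u F.≟ v | v F.≟ u
  ... | yes _ | yes _ = cong₂ _∧_ (cong not (adj-sym G u v)) refl
  ... | no _  | no _  = cong₂ _∧_ (cong not (adj-sym G u v)) refl
  ... | yes p | no q  = ⊥-elim (q (sym p))
  ... | no p  | yes q = ⊥-elim (p (sym q))
  irc : ∀ u → (not (adj G u u) ∧ not ⌊ u F.≟ u ⌋) ≡ false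
  irc u with u F.≟ u
  ... | yes _ = ∧-zeroʳ _
  ... | no p = ⊥-elim (p refl)

data Walk {n : ℕ} (E : Fin n → Fin n → Set) : Fin n → Fin n → Set where
  here : ∀ {u} → Walk E u u
  step : ∀ {u v w} → E u v → Walk E v w → Walk E u w

Edge : ∀ {n} → Graph n → Fin n → Fin n → Set
Edge G u v = adj G u v ≡ true

Connected : ∀ {n} → Graph n → Set
Connected G = ∀ u v → Walk (Edge G) u v

IsCycle : ∀ {n} → (Fin n → Fin n → Set) → List (Fin n) → Set
IsCycle E []       = ⊥
IsCycle E (v ∷ ws) = Unique (v ∷ ws) × Linked E (v ∷ ws ++ [ v ]) × (2 ≤ length ws)

record STree {n : ℕ} (G : Graph n) (x y z : Fin n) : Set where
  field
    inT   : Fin n → Bool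
    eT    : Fin n → Fin n → Bool
    eT-sym : ∀ u v → eT u v ≡ eT v u
    eT-sub : ∀ u v → eT u v ≡ true → adj G u v ≡ true
    eT-in  : ∀ u v → eT u v ≡ true → inT u ≡ true
    x∈T : inT x ≡ true
    y∈T : inT y ≡ true
    z∈T : inT z ≡ true
    connected : ∀ u v → inT u ≡ true → inT v ≡ true → Walk (λ a b → eT a b ≡ true) u v
    acyclic   : ∀ cs → ¬ IsCycle (λ a b → eT a b ≡ true) cs
open STree public

NotInS : ∀ {n} → Fin n → Fin n → Fin n → Fin n → Set
NotInS x y z u = u ≢ x × u ≢ y × u ≢ z

VertexRainbow : ∀ {n k} {G : Graph n} {x y z : Fin n} → (Fin n → Fin k) → STree G x y z → Set
VertexRainbow {x = x} {y} {z} c T =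
  ∀ u w → inT T u ≡ true → inT T w ≡ true → NotInS x y z u → NotInS x y z w →
  u ≢ w → c u ≢ c w

ExactlyS : ∀ {n} {G : Graph n} {x y z : Fin n} → STree G x y z → Set
ExactlyS {x = x} {y} {z} T = ∀ u → inT T u ≡ true → NotInS x y z u → ⊥

Distinct3 : ∀ {n} → Fin n → Fin n → Fin n → Set
Distinct3 x y z = x ≢ y × x ≢ z × y ≢ z

Is3VRColoring : ∀ {n k} → Graph n → (Fin n → Fin k) → Set
Is3VRColoring G c = ∀ x y z → Distinct3 x y z → Σ (STree G x y z) (λ T → VertexRainbow c T)

-- G admits a 3-vertex-rainbow colouring with k colours
-- (k = 0 meaning every 3-subset S has an S-tree with vertex set exactly S).
Has3VRColoring : ∀ {n} → Graph n → ℕ → Set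
Has3VRColoring {n} G k =
  (k ≡ 0 × (∀ x y z → Distinct3 x y z → Σ (STree G x y z) ExactlyS))
  ⊎ Σ (Fin n → Fin k) (Is3VRColoring G)

Rvx3 : ∀ {n} → Graph n → ℕ → Set
Rvx3 G k = Has3VRColoring G k × (∀ j → j < k → ¬ Has3VRColoring G j)

-- If rvx₃(G) = 0, every three vertices of G induce a connected subgraph, so no vertex of G has
-- two distinct non-neighbours.  A connected graph on at least three vertices contains a path
-- u – v – w, and if the complement of G is connected its centre v is such a vertex; hence both
-- rvx₃(G) and rvx₃(Ḡ) are positive.
--
-- For sharpness, blow one vertex of the five-cycle up into an independent set of n − 4
-- vertices.  This graph and its complement have diameter two; in the graph every independent
-- triple has a common neighbour, and the complement has no independent triple since the graph
-- is triangle-free.  In such a graph every triple spans a tree with at most one further vertex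
-- (a star, or a path through an edge of the triple), so a single colour suffices.
module Submission where

open import Defs
open import Data.Nat using (ℕ; zero; suc; _≤_; _+_; s≤s; z≤n)
open import Data.Nat.Properties using (≤-trans; +-mono-≤)
open import Data.Fin using (Fin; zero; suc; _≟_; _↑ˡ_)
open import Data.Fin.Patterns using (0F; 1F; 2F; 3F; 4F)
open import Data.Fin.Properties using (all?; any?; ¬Fin0)
open import Data.Bool using (true; false; _∨_)
import Data.Bool as Bool
open import Data.Bool.Properties using (∨-comm)
open import Data.List using (List; []; _∷_; [_]; _++_)
open import Data.List.Relation.Unary.All using (All; []; _∷_; lookup)
open import Data.List.Relation.Unary.Any using (here; there)
open import Data.List.Relation.Unary.AllPairs using (_∷_)
open import Data.List.Relation.Unary.Linked using (Linked; [-]; _∷_)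
open import Data.List.Membership.Propositional using (_∈_)
import Data.List.Membership.DecPropositional as DecMembership
open import Data.List.Relation.Binary.Subset.Propositional using (_⊆_)
open import Data.List.Relation.Binary.Subset.Propositional.Properties using (∷⁺ʳ)
open import Data.Product using (Σ; ∃-syntax; _×_; _,_; proj₁; proj₂; uncurry)
open import Data.Product.Properties using (≡-dec)
open import Data.Sum using (_⊎_; inj₁; inj₂; [_,_]′)
open import Data.Empty using (⊥; ⊥-elim)
open import Function using (_∘_; const)
open import Relation.Nullary using (¬_; Dec; yes; no; does; ¬?)
open import Relation.Nullary.Decidable using (dec-true; from-yes; _⊎-dec_; _×-dec_; _→-dec_)
open import Relation.Binary.PropositionalEquality using (_≡_; _≢_; refl; sym; trans; cong; subst; ≢-sym)

pattern ∈₀ = here refl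
pattern ∈₁ = there ∈₀
pattern ∈₂ = there ∈₁
pattern ∈₃ = there ∈₂

all∈⇒⊆ : ∀ {A : Set} {xs ys : List A} → All (_∈ ys) xs → xs ⊆ ys
all∈⇒⊆ = lookup

does⇒ : ∀ {A : Set} (a? : Dec A) → does a? ≡ true → A
does⇒ (yes a) _ = a

module _ {n : ℕ} {E : Fin n → Fin n → Set} where

  _◅◅_ : ∀ {u v w} → Walk E u v → Walk E v w → Walk E u w
  here     ◅◅ q = q
  step e p ◅◅ q = step e (p ◅◅ q)

  walk-reverse : (∀ {u v} → E u v → E v u) → ∀ {u v} → Walk E u v → Walk E v u
  walk-reverse E-sym here       = here
  walk-reverse E-sym (step e p) = walk-reverse E-sym p ◅◅ step (E-sym e) here

  walk-exits : ∀ {P : Fin n → Set} → (∀ u → Dec (P u)) → ∀ {s t} → Walk E s t → P s → ¬ P t →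
               ∃[ u ] ∃[ v ] (E u v × P u × ¬ P v)
  walk-exits P? here       ps ¬pt = ⊥-elim (¬pt ps)
  walk-exits P? (step {v = v} e w) ps ¬pt with P? v
  ... | yes pv = walk-exits P? w pv ¬pt
  ... | no ¬pv = _ , v , e , ps , ¬pv

walk-map : ∀ {n} {E E′ : Fin n → Fin n → Set} → (∀ {u v} → E u v → E′ u v) →
           ∀ {u v} → Walk E u v → Walk E′ u v
walk-map f here       = here
walk-map f (step e p) = step (f e) (walk-map f p)

EdgeDisjoint : ∀ {n} → Graph n → Graph n → Set
EdgeDisjoint H G = ∀ u v → Edge H u v → ¬ Edge G u v

module _ {n : ℕ} {G : Graph n} where

  edge-sym : ∀ {u v} → Edge G u v → Edge G v u
  edge-sym {u} {v} e = trans (adj-sym G v u) e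

  edge⇒≢ : ∀ {u v} → Edge G u v → u ≢ v
  edge⇒≢ {u} e refl with trans (sym (adj-irrefl G u)) e
  ... | ()

  complement-edge⇒¬edge : EdgeDisjoint (complement G) G
  complement-edge⇒¬edge u v ē e with adj G u v
  complement-edge⇒¬edge u v () refl | true

  edge⇒¬complement-edge : EdgeDisjoint G (complement G)
  edge⇒¬complement-edge u v e ē = complement-edge⇒¬edge u v ē e

  ¬edge⇒complement-edge : ∀ {u v} → u ≢ v → ¬ Edge G u v → Edge (complement G) u v
  ¬edge⇒complement-edge {u} {v} u≢v ¬e with adj G u v | u ≟ v
  ... | true  | _      = ⊥-elim (¬e refl)
  ... | false | yes eq = ⊥-elim (u≢v eq)
  ... | false | no _   = refl

  ¬complement-edge⇒edge : ∀ {u v} → u ≢ v → ¬ Edge (complement G) u v → Edge G u v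
  ¬complement-edge⇒edge {u} {v} u≢v ¬ē with adj G u v | u ≟ v
  ... | true  | _      = refl
  ... | false | yes eq = ⊥-elim (u≢v eq)
  ... | false | no _   = ⊥-elim (¬ē refl)

edge? : ∀ {n} (G : Graph n) (u v : Fin n) → Dec (Edge G u v)
edge? G u v = adj G u v Bool.≟ true

Branching : ∀ {n} → (Fin n → Fin n → Set) → Fin n → Set
Branching E v = ∃[ x ] ∃[ y ] (E v x × E v y × x ≢ y)

no-three-distinct-in-pair : ∀ {n} {b c u v w : Fin n} → Distinct3 u v w →
  u ≡ b ⊎ u ≡ c → v ≡ b ⊎ v ≡ c → w ≡ b ⊎ w ≡ c → ⊥
no-three-distinct-in-pair (u≢v , _ , _)   (inj₁ refl) (inj₁ refl) _           = u≢v refl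
no-three-distinct-in-pair (u≢v , _ , _)   (inj₂ refl) (inj₂ refl) _           = u≢v refl
no-three-distinct-in-pair (_ , u≢w , _)   (inj₁ refl) (inj₂ refl) (inj₁ refl) = u≢w refl
no-three-distinct-in-pair (_ , _ , v≢w)   (inj₁ refl) (inj₂ refl) (inj₂ refl) = v≢w refl
no-three-distinct-in-pair (_ , _ , v≢w)   (inj₂ refl) (inj₁ refl) (inj₁ refl) = v≢w refl
no-three-distinct-in-pair (_ , u≢w , _)   (inj₂ refl) (inj₁ refl) (inj₂ refl) = u≢w refl

module _ {n : ℕ} {E : Fin n → Fin n → Set} (E-sym : ∀ {u v} → E u v → E v u) where

  linked-last : ∀ {u w} ws → Linked E (u ∷ ws ++ [ w ]) → ∃[ l ] (l ∈ u ∷ ws × E l w)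
  linked-last []       (e ∷ [-])  = _ , ∈₀ , e
  linked-last (_ ∷ ws) (_ ∷ rest) with linked-last ws rest
  ... | l , l∈ , e = l , there l∈ , e

  linked-second : ∀ {u w} ws → Linked E (u ∷ ws ++ [ w ]) → ∃[ x ] (x ∈ w ∷ ws × E u x)
  linked-second []      (e ∷ _) = _ , ∈₀ , e
  linked-second (x ∷ _) (e ∷ _) = x , ∈₁ , e

  cycle-branching : ∀ {cs} → IsCycle E cs →
    ∃[ v₀ ] ∃[ v₁ ] ∃[ v₂ ] (Distinct3 v₀ v₁ v₂ × Branching E v₀ × Branching E v₁ × Branching E v₂)
  cycle-branching {v₀ ∷ v₁ ∷ v₂ ∷ ws}
    ((v₀≢v₁ ∷ v₀≢v₂ ∷ _) ∷ (v₁≢v₂ ∷ v₁∉ws) ∷ _ , e₀₁ ∷ e₁₂ ∷ rest , _) =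
    v₀ , v₁ , v₂ , (v₀≢v₁ , v₀≢v₂ , v₁≢v₂) , branching₀ , branching₁ , branching₂
    where
    branching₀ : Branching E v₀
    branching₀ with linked-last ws rest
    ... | l , l∈ , eₗ₀ = v₁ , l , e₀₁ , E-sym eₗ₀ , lookup (v₁≢v₂ ∷ v₁∉ws) l∈
    branching₁ : Branching E v₁
    branching₁ = v₀ , v₂ , E-sym e₀₁ , e₁₂ , v₀≢v₂
    branching₂ : Branching E v₂
    branching₂ with linked-second ws rest
    ... | x , x∈ , e₂ₓ = v₁ , x , E-sym e₁₂ , e₂ₓ , lookup (≢-sym v₀≢v₁ ∷ v₁∉ws) x∈
  cycle-branching {[]} ()
  cycle-branching {_ ∷ []} (_ , _ , ())
  cycle-branching {_ ∷ _ ∷ []} (_ , _ , s≤s ())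

  acyclic-if-branching-only-at : (b c : Fin n) →
    (∀ {v x y} → E v x → E v y → v ≢ b → v ≢ c → x ≡ y) → ∀ cs → ¬ IsCycle E cs
  acyclic-if-branching-only-at b c unbranched cs cycle with cycle-branching cycle
  ... | _ , _ , _ , distinct , br₀ , br₁ , br₂ =
    no-three-distinct-in-pair distinct (at-hub br₀) (at-hub br₁) (at-hub br₂)
    where
    at-hub : ∀ {v} → Branching E v → v ≡ b ⊎ v ≡ c
    at-hub {v} (_ , _ , ex , ey , x≢y) with v ≟ b | v ≟ c
    ... | yes v≡b | _       = inj₁ v≡b
    ... | no _    | yes v≡c = inj₂ v≡c
    ... | no v≢b  | no v≢c  = ⊥-elim (x≢y (unbranched ex ey v≢b v≢c))

Adjacent : ∀ {n} → List (Fin n × Fin n) → Fin n → Fin n → Set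
Adjacent es u v = (u , v) ∈ es ⊎ (v , u) ∈ es

-- A subtree of G given by vertex and edge lists.  Acyclicity is certified by requiring that only
-- hub₁ and hub₂ may have two distinct neighbours, which is enough for trees on four vertices.
record ListTree {n : ℕ} (G : Graph n) : Set where
  field
    vertices   : List (Fin n)
    edges      : List (Fin n × Fin n)
    edges⊆G    : All (uncurry (Edge G)) edges
    ends∈      : All (λ e → proj₁ e ∈ vertices × proj₂ e ∈ vertices) edges
    root       : Fin n
    to-root    : All (λ v → Walk (Adjacent edges) v root) vertices
    hub₁ hub₂  : Fin n
    unbranched : ∀ {v x y} → Adjacent edges v x → Adjacent edges v y → v ≢ hub₁ → v ≢ hub₂ → x ≡ y

module _ {n : ℕ} {G : Graph n} (T : ListTree G) where
  open ListTree T
  open DecMembership (_≟_ {n}) using (_∈?_)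
  open DecMembership (≡-dec (_≟_ {n}) (_≟_ {n})) using () renaming (_∈?_ to _∈ₑ?_)

  private
    adjacent? : ∀ u v → Dec (Adjacent edges u v)
    adjacent? u v = ((u , v) ∈ₑ? edges) ⊎-dec ((v , u) ∈ₑ? edges)

    adjacent⇒edge : ∀ {u v} → Adjacent edges u v → Edge G u v
    adjacent⇒edge (inj₁ uv) = lookup edges⊆G uv
    adjacent⇒edge (inj₂ vu) = edge-sym {G = G} (lookup edges⊆G vu)

    adjacent⇒vertex : ∀ {u v} → Adjacent edges u v → u ∈ vertices
    adjacent⇒vertex (inj₁ uv) = proj₁ (lookup ends∈ uv)
    adjacent⇒vertex (inj₂ vu) = proj₂ (lookup ends∈ vu)

    tree-edge-sym : ∀ u v → does (adjacent? u v) ≡ does (adjacent? v u)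
    tree-edge-sym u v = ∨-comm (does ((u , v) ∈ₑ? edges)) _

    walk-in-tree : ∀ {u} → u ∈ vertices → Walk (λ a b → does (adjacent? a b) ≡ true) u root
    walk-in-tree u∈ = walk-map (λ {a} {b} → dec-true (adjacent? a b)) (lookup to-root u∈)

  toSTree : ∀ {x y z} → x ∈ vertices → y ∈ vertices → z ∈ vertices → STree G x y z
  toSTree x∈ y∈ z∈ = record
    { inT       = λ u → does (u ∈? vertices)
    ; eT        = λ u v → does (adjacent? u v)
    ; eT-sym    = tree-edge-sym
    ; eT-sub    = λ u v → adjacent⇒edge ∘ does⇒ (adjacent? u v)
    ; eT-in     = λ u v → dec-true (u ∈? vertices) ∘ adjacent⇒vertex ∘ does⇒ (adjacent? u v)
    ; x∈T       = dec-true (_ ∈? vertices) x∈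
    ; y∈T       = dec-true (_ ∈? vertices) y∈
    ; z∈T       = dec-true (_ ∈? vertices) z∈
    ; connected = λ u v u∈ v∈ →
        walk-in-tree (does⇒ (u ∈? vertices) u∈)
        ◅◅ walk-reverse flip (walk-in-tree (does⇒ (v ∈? vertices) v∈))
    ; acyclic   = acyclic-if-branching-only-at flip hub₁ hub₂ λ ex ey →
        unbranched (does⇒ (adjacent? _ _) ex) (does⇒ (adjacent? _ _) ey)
    }
    where
    flip : ∀ {a b} → does (adjacent? a b) ≡ true → does (adjacent? b a) ≡ true
    flip {a} {b} e = trans (tree-edge-sym b a) e

  toSTree-rainbow : ∀ {k x y z e} (c : Fin n → Fin k)
    (x∈ : x ∈ vertices) (y∈ : y ∈ vertices) (z∈ : z ∈ vertices) →
    vertices ⊆ e ∷ x ∷ y ∷ z ∷ [] → VertexRainbow c (toSTree x∈ y∈ z∈)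
  toSTree-rainbow {e = e} c _ _ _ within u w u∈ w∈ u∉S w∉S u≢w _ =
    u≢w (trans (is-extra (within (does⇒ (u ∈? vertices) u∈)) u∉S)
               (sym (is-extra (within (does⇒ (w ∈? vertices) w∈)) w∉S)))
    where
    is-extra : ∀ {x y z u} → u ∈ e ∷ x ∷ y ∷ z ∷ [] → NotInS x y z u → u ≡ e
    is-extra (here u≡e)                         _             = u≡e
    is-extra (there (here u≡x))                 (u≢x , _)     = ⊥-elim (u≢x u≡x)
    is-extra (there (there (here u≡y)))         (_ , u≢y , _) = ⊥-elim (u≢y u≡y)
    is-extra (there (there (there (here u≡z)))) (_ , _ , u≢z) = ⊥-elim (u≢z u≡z)
    is-extra (there (there (there (there ())))) _

module _ {n : ℕ} {G : Graph n} where

  star : ∀ {a l₁ l₂ l₃} → Edge G a l₁ → Edge G a l₂ → Edge G a l₃ → ListTree G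
  star {a} {l₁} {l₂} {l₃} e₁ e₂ e₃ = record
    { vertices   = a ∷ l₁ ∷ l₂ ∷ l₃ ∷ []
    ; edges      = es
    ; edges⊆G    = e₁ ∷ e₂ ∷ e₃ ∷ []
    ; ends∈      = (∈₀ , ∈₁) ∷ (∈₀ , ∈₂) ∷ (∈₀ , ∈₃) ∷ []
    ; root       = a
    ; to-root    = here ∷ step (inj₂ ∈₀) here ∷ step (inj₂ ∈₁) here ∷ step (inj₂ ∈₂) here ∷ []
    ; hub₁       = a
    ; hub₂       = a
    ; unbranched = λ ex ey v≢a _ → trans (to-centre ex v≢a) (sym (to-centre ey v≢a))
    }
    where
    es = (a , l₁) ∷ (a , l₂) ∷ (a , l₃) ∷ []
    centred : All (λ e → proj₁ e ≡ a) es
    centred = refl ∷ refl ∷ refl ∷ []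
    to-centre : ∀ {v x} → Adjacent es v x → v ≢ a → x ≡ a
    to-centre (inj₁ vx) v≢a = ⊥-elim (v≢a (lookup centred vx))
    to-centre (inj₂ xv) _   = lookup centred xv

  path : ∀ {a b c d} → a ≢ d → Edge G a b → Edge G b c → Edge G c d → ListTree G
  path {a} {b} {c} {d} a≢d e₁ e₂ e₃ = record
    { vertices   = a ∷ b ∷ c ∷ d ∷ []
    ; edges      = es
    ; edges⊆G    = e₁ ∷ e₂ ∷ e₃ ∷ []
    ; ends∈      = (∈₀ , ∈₁) ∷ (∈₁ , ∈₂) ∷ (∈₂ , ∈₃) ∷ []
    ; root       = a
    ; to-root    = here ∷ b→a ∷ c→a ∷ step (inj₂ ∈₂) c→a ∷ []
    ; hub₁       = b
    ; hub₂       = c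
    ; unbranched = unbranched
    }
    where
    es = (a , b) ∷ (b , c) ∷ (c , d) ∷ []
    b→a : Walk (Adjacent es) b a
    b→a = step (inj₂ ∈₀) here
    c→a : Walk (Adjacent es) c a
    c→a = step (inj₂ ∈₁) b→a
    end-neighbour : ∀ {v x} → v ≢ b → v ≢ c → Adjacent es v x → (v ≡ a × x ≡ b) ⊎ (v ≡ d × x ≡ c)
    end-neighbour _   _   (inj₁ ∈₀) = inj₁ (refl , refl)
    end-neighbour v≢b _   (inj₁ ∈₁) = ⊥-elim (v≢b refl)
    end-neighbour _   v≢c (inj₁ ∈₂) = ⊥-elim (v≢c refl)
    end-neighbour v≢b _   (inj₂ ∈₀) = ⊥-elim (v≢b refl)
    end-neighbour _   v≢c (inj₂ ∈₁) = ⊥-elim (v≢c refl)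
    end-neighbour _   _   (inj₂ ∈₂) = inj₂ (refl , refl)
    end-neighbour _   _   (inj₁ (there (there (there ()))))
    end-neighbour _   _   (inj₂ (there (there (there ()))))
    unbranched : ∀ {v x y} → Adjacent es v x → Adjacent es v y → v ≢ b → v ≢ c → x ≡ y
    unbranched ex ey v≢b v≢c with end-neighbour v≢b v≢c ex | end-neighbour v≢b v≢c ey
    ... | inj₁ (_ , x≡b)   | inj₁ (_ , y≡b)   = trans x≡b (sym y≡b)
    ... | inj₂ (_ , x≡c)   | inj₂ (_ , y≡c)   = trans x≡c (sym y≡c)
    ... | inj₁ (v≡a , _)   | inj₂ (v≡d , _)   = ⊥-elim (a≢d (trans (sym v≡a) v≡d))
    ... | inj₂ (v≡d , _)   | inj₁ (v≡a , _)   = ⊥-elim (a≢d (trans (sym v≡a) v≡d))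

record SteinerTree≤1 {n : ℕ} (G : Graph n) (S : List (Fin n)) : Set where
  field
    tree   : ListTree G
    spans  : S ⊆ ListTree.vertices tree
    extra  : Fin n
    within : ListTree.vertices tree ⊆ extra ∷ S

module _ {n : ℕ} {G : Graph n} where

  steiner-reorder : ∀ {S S′} → S′ ⊆ S → S ⊆ S′ → SteinerTree≤1 G S → SteinerTree≤1 G S′
  steiner-reorder S′⊆S S⊆S′ T = record
    { tree = tree ; spans = spans ∘ S′⊆S ; extra = extra ; within = ∷⁺ʳ extra S⊆S′ ∘ within }
    where open SteinerTree≤1 T

  steiner⇒rainbow-tree : ∀ {k x y z} (c : Fin n → Fin k) →
    SteinerTree≤1 G (x ∷ y ∷ z ∷ []) → Σ (STree G x y z) (VertexRainbow c)
  steiner⇒rainbow-tree c T = toSTree tree (spans ∈₀) (spans ∈₁) (spans ∈₂)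
                           , toSTree-rainbow tree c (spans ∈₀) (spans ∈₁) (spans ∈₂) within
    where open SteinerTree≤1 T

-- Graphs of diameter at most two

Near : ∀ {n} → Graph n → Fin n → Fin n → Set
Near G u v = Edge G u v ⊎ ∃[ w ] (Edge G u w × Edge G w v)

Diameter≤2 : ∀ {n} → Graph n → Set
Diameter≤2 G = ∀ u v → u ≢ v → Near G u v

Independent : ∀ {n} → Graph n → Fin n → Fin n → Fin n → Set
Independent G x y z = ¬ Edge G x y × ¬ Edge G x z × ¬ Edge G y z

Dominated : ∀ {n} → Graph n → Fin n → Fin n → Fin n → Set
Dominated G x y z = ∃[ w ] (Edge G w x × Edge G w y × Edge G w z)

IndependentTriplesDominated : ∀ {n} → Graph n → Set
IndependentTriplesDominated G = ∀ x y z → Distinct3 x y z → Independent G x y z → Dominated G x y z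

TriangleFree : ∀ {n} → Graph n → Set
TriangleFree G = ∀ x y z → ¬ (Edge G x y × Edge G x z × Edge G y z)

near? : ∀ {n} (G : Graph n) (u v : Fin n) → Dec (Near G u v)
near? G u v = edge? G u v ⊎-dec any? (λ w → edge? G u w ×-dec edge? G w v)

diameter≤2⇒connected : ∀ {n} {G : Graph n} → Diameter≤2 G → Connected G
diameter≤2⇒connected diameter u v with u ≟ v
... | yes refl = here
... | no u≢v with diameter u v u≢v
...   | inj₁ e             = step e here
...   | inj₂ (_ , e₁ , e₂) = step e₁ (step e₂ here)

complement-of-triangle-free : ∀ {n} {G : Graph n} →
  TriangleFree G → IndependentTriplesDominated (complement G)
complement-of-triangle-free {G = G} triangle-free x y z (x≢y , x≢z , y≢z) (¬xy , ¬xz , ¬yz) =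
  ⊥-elim (triangle-free x y z ( ¬complement-edge⇒edge {G = G} x≢y ¬xy
                              , ¬complement-edge⇒edge {G = G} x≢z ¬xz
                              , ¬complement-edge⇒edge {G = G} y≢z ¬yz))

module _ {n : ℕ} {G : Graph n} (diameter : Diameter≤2 G) where

  -- A path b – a – c is a star centred at a with a repeated leaf.
  steiner-through-edge : ∀ {a b c} → Edge G a b → c ≢ a → c ≢ b → SteinerTree≤1 G (a ∷ b ∷ c ∷ [])
  steiner-through-edge {a} {b} {c} ab c≢a c≢b with edge? G a c | edge? G b c
  ... | yes ac | _ = record
    { tree = star ab ac ac ; spans = all∈⇒⊆ (∈₀ ∷ ∈₁ ∷ ∈₂ ∷ [])
    ; extra = a ; within = all∈⇒⊆ (∈₀ ∷ ∈₂ ∷ ∈₃ ∷ ∈₃ ∷ []) }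
  ... | no _ | yes bc = record
    { tree = star (edge-sym {G = G} ab) bc bc ; spans = all∈⇒⊆ (∈₁ ∷ ∈₀ ∷ ∈₂ ∷ [])
    ; extra = b ; within = all∈⇒⊆ (∈₀ ∷ ∈₁ ∷ ∈₃ ∷ ∈₃ ∷ []) }
  ... | no ¬ac | no _ with diameter c a c≢a
  ...   | inj₁ ca = ⊥-elim (¬ac (edge-sym {G = G} ca))
  ...   | inj₂ (w , cw , wa) = record
    { tree = path c≢b cw wa ab ; spans = all∈⇒⊆ (∈₂ ∷ ∈₃ ∷ ∈₀ ∷ [])
    ; extra = w ; within = all∈⇒⊆ (∈₃ ∷ ∈₀ ∷ ∈₁ ∷ ∈₂ ∷ []) }

  steiner≤1 : IndependentTriplesDominated G →
    ∀ x y z → Distinct3 x y z → SteinerTree≤1 G (x ∷ y ∷ z ∷ [])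
  steiner≤1 dominated x y z distinct@(x≢y , x≢z , y≢z) with edge? G x y | edge? G x z | edge? G y z
  ... | yes xy | _      | _      = steiner-through-edge xy (≢-sym x≢z) (≢-sym y≢z)
  ... | no _   | yes xz | _      =
    steiner-reorder (all∈⇒⊆ (∈₀ ∷ ∈₂ ∷ ∈₁ ∷ [])) (all∈⇒⊆ (∈₀ ∷ ∈₂ ∷ ∈₁ ∷ []))
      (steiner-through-edge xz (≢-sym x≢y) y≢z)
  ... | no _   | no _   | yes yz =
    steiner-reorder (all∈⇒⊆ (∈₂ ∷ ∈₀ ∷ ∈₁ ∷ [])) (all∈⇒⊆ (∈₁ ∷ ∈₂ ∷ ∈₀ ∷ []))
      (steiner-through-edge yz x≢y x≢z)
  ... | no ¬xy | no ¬xz | no ¬yz with dominated x y z distinct (¬xy , ¬xz , ¬yz)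
  ...   | w , wx , wy , wz = record
    { tree = star wx wy wz ; spans = all∈⇒⊆ (∈₁ ∷ ∈₂ ∷ ∈₃ ∷ []) ; extra = w ; within = λ u∈ → u∈ }

  every-colouring-is3VR : IndependentTriplesDominated G → ∀ {k} (c : Fin n → Fin k) → Is3VRColoring G c
  every-colouring-is3VR dominated c x y z distinct =
    steiner⇒rainbow-tree c (steiner≤1 dominated x y z distinct)

-- Colourings with no colour

Cherry : ∀ {n} → Graph n → Set
Cherry H = ∃[ v ] ∃[ u ] ∃[ w ] (Edge H v u × Edge H v w × u ≢ w)

cherry : ∀ {n} {H : Graph n} → Connected H → 3 ≤ n → Cherry H
cherry {H = H} connected (s≤s (s≤s (s≤s _))) with connected 0F 1F
... | step {v = p} e₀ₚ _ = leave-edge third-vertex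
  where
  third-vertex : ∃[ t ] (t ≢ 0F × t ≢ p)
  third-vertex with p ≟ 1F
  ... | yes refl = 2F , (λ ()) , (λ ())
  ... | no p≢1   = 1F , (λ ()) , ≢-sym p≢1

  on-edge? : ∀ s → Dec (s ≡ 0F ⊎ s ≡ p)
  on-edge? s = (s ≟ 0F) ⊎-dec (s ≟ p)

  leave-edge : ∃[ t ] (t ≢ 0F × t ≢ p) → Cherry H
  leave-edge (t , t≢0 , t≢p) with walk-exits on-edge? (connected 0F t) (inj₁ refl) [ t≢0 , t≢p ]′
  ... | _ , v , uv , inj₁ refl , v∉ = 0F , p , v , e₀ₚ , uv , λ p≡v → v∉ (inj₂ (sym p≡v))
  ... | _ , v , uv , inj₂ refl , v∉ =
    p , 0F , v , edge-sym {G = H} e₀ₚ , uv , λ 0≡v → v∉ (inj₁ (sym 0≡v))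

exact-tree-neighbour : ∀ {n} {G : Graph n} {x y z} (T : STree G x y z) → ExactlyS T → x ≢ y →
  Edge G x y ⊎ Edge G x z
exact-tree-neighbour {G = G} {x} {y} {z} T exact x≢y with connected T x y (x∈T T) (y∈T T)
... | here = ⊥-elim (x≢y refl)
... | step {v = t} e _ with t ≟ x | t ≟ y | t ≟ z
...   | yes refl | _        | _        = ⊥-elim (edge⇒≢ {G = G} (eT-sub T t t e) refl)
...   | no _     | yes refl | _        = inj₁ (eT-sub T x t e)
...   | no _     | no _     | yes refl = inj₂ (eT-sub T x t e)
...   | no t≢x   | no t≢y   | no t≢z   =
  ⊥-elim (exact t (eT-in T t x (trans (eT-sym T t x) e)) (t≢x , t≢y , t≢z))

no-colourless : ∀ {n} {G : Graph n} (H : Graph n) → Connected H → 3 ≤ n →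
  EdgeDisjoint H G → ¬ Has3VRColoring G 0
no-colourless H _ (s≤s _) _ (inj₂ (c , _)) = ¬Fin0 (c 0F)
no-colourless H connected 3≤n disjoint (inj₁ (_ , exact-trees)) with cherry {H = H} connected 3≤n
... | v , u , w , vu , vw , u≢w
  with exact-trees v u w (edge⇒≢ {G = H} vu , edge⇒≢ {G = H} vw , u≢w)
... | T , exact with exact-tree-neighbour T exact (edge⇒≢ {G = H} vu)
... | inj₁ vu′ = disjoint _ _ vu vu′
... | inj₂ vw′ = disjoint _ _ vw vw′

rvx3-positive : ∀ {n k} {G : Graph n} (H : Graph n) → Connected H → 3 ≤ n →
  EdgeDisjoint H G → Rvx3 G k → 1 ≤ k
rvx3-positive {k = zero}  H connected 3≤n disjoint (has , _) =
  ⊥-elim (no-colourless H connected 3≤n disjoint has)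
rvx3-positive {k = suc _} _ _ _ _ _ = s≤s z≤n

rvx3≡1 : ∀ {n} {G : Graph n} (H : Graph n) → Connected H → 3 ≤ n →
  EdgeDisjoint H G → Diameter≤2 G → IndependentTriplesDominated G → Rvx3 G 1
rvx3≡1 H connected 3≤n disjoint diameter dominated =
  inj₂ (const 0F , every-colouring-is3VR diameter dominated (const 0F)) ,
  λ { zero _ → no-colourless H connected 3≤n disjoint ; (suc _) (s≤s ()) }

-- Blowing up the five-cycle

-- u ~ v iff f u ~ f v, so every fibre of f becomes an independent set.
pullback : ∀ {k n} → Graph k → (Fin n → Fin k) → Graph n
pullback B f = record
  { adj        = λ u v → adj B (f u) (f v)
  ; adj-sym    = λ u v → adj-sym B (f u) (f v)
  ; adj-irrefl = adj-irrefl B ∘ f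
  }

complement-pullback-edge : ∀ {k n} {B : Graph k} {f : Fin n → Fin k} {u v} →
  Edge (complement B) (f u) (f v) → Edge (complement (pullback B f)) u v
complement-pullback-edge {B = B} {f = f} ē =
  ¬edge⇒complement-edge {G = pullback B f} (edge⇒≢ {G = complement B} ē ∘ cong f)
                                            (complement-edge⇒¬edge {G = B} _ _ ē)

module _ {k n : ℕ} (B : Graph k) (f : Fin n → Fin k) {s : Fin k → Fin n}
         (section : ∀ a → f (s a) ≡ a) where

  private
    towards-section : ∀ {R : Fin k → Fin k → Set} {a c} → R a c → R a (f (s c))
    towards-section {R} {a} {c} = subst (R a) (sym (section c))

    from-section : ∀ {R : Fin k → Fin k → Set} {a c} → R c a → R (f (s c)) a
    from-section {R} {a} {c} = subst (λ d → R d a) (sym (section c))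

  -- The hypothesis includes a = b: distinct vertices in one fibre need a common neighbour.
  pullback-diameter≤2 : (∀ a b → Near B a b) → Diameter≤2 (pullback B f)
  pullback-diameter≤2 near u v _ with near (f u) (f v)
  ... | inj₁ e             = inj₁ e
  ... | inj₂ (c , e₁ , e₂) = inj₂ (s c , towards-section {Edge B} e₁ , from-section {Edge B} e₂)

  complement-pullback-diameter≤2 : Diameter≤2 (complement B) → Diameter≤2 (complement (pullback B f))
  complement-pullback-diameter≤2 diameter u v u≢v with f u ≟ f v
  ... | yes fu≡fv = inj₁ (¬edge⇒complement-edge {G = pullback B f} u≢v λ e → edge⇒≢ {G = B} e fu≡fv)
  ... | no fu≢fv with diameter (f u) (f v) fu≢fv
  ...   | inj₁ ē             = inj₁ (complement-pullback-edge {B = B} {f} ē)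
  ...   | inj₂ (c , ē₁ , ē₂) =
    inj₂ ( s c
         , complement-pullback-edge {B = B} {f} (towards-section {Edge (complement B)} ē₁)
         , complement-pullback-edge {B = B} {f} (from-section {Edge (complement B)} ē₂))

  pullback-dominated : (∀ a b c → Independent B a b c → Dominated B a b c) →
    IndependentTriplesDominated (pullback B f)
  pullback-dominated dominated x y z _ independent with dominated (f x) (f y) (f z) independent
  ... | c , e₁ , e₂ , e₃ =
    s c , from-section {Edge B} e₁ , from-section {Edge B} e₂ , from-section {Edge B} e₃

rotate : Fin 5 → Fin 5
rotate 0F = 1F
rotate 1F = 2F
rotate 2F = 3F
rotate 3F = 4F
rotate 4F = 0F

C₅ : Graph 5
C₅ = record
  { adj        = λ u v → does (v ≟ rotate u) ∨ does (u ≟ rotate v)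
  ; adj-sym    = λ u v → ∨-comm (does (v ≟ rotate u)) _
  ; adj-irrefl = λ { 0F → refl ; 1F → refl ; 2F → refl ; 3F → refl ; 4F → refl }
  }

C₅-near : ∀ a b → Near C₅ a b
C₅-near = from-yes (all? λ a → all? λ b → near? C₅ a b)

complement-C₅-diameter≤2 : Diameter≤2 (complement C₅)
complement-C₅-diameter≤2 = from-yes (all? λ a → all? λ b → ¬? (a ≟ b) →-dec near? (complement C₅) a b)

C₅-triangle-free : TriangleFree C₅
C₅-triangle-free = from-yes (all? λ x → all? λ y → all? λ z →
  ¬? (edge? C₅ x y ×-dec edge? C₅ x z ×-dec edge? C₅ y z))

C₅-independent-dominated : ∀ a b c → Independent C₅ a b c → Dominated C₅ a b c
C₅-independent-dominated = from-yes (all? λ a → all? λ b → all? λ c →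
  (¬? (edge? C₅ a b) ×-dec ¬? (edge? C₅ a c) ×-dec ¬? (edge? C₅ b c)) →-dec
  any? λ w → edge? C₅ w a ×-dec edge? C₅ w b ×-dec edge? C₅ w c)

squash : ∀ {m} → Fin (5 + m) → Fin 5
squash 0F                         = 0F
squash 1F                         = 1F
squash 2F                         = 2F
squash 3F                         = 3F
squash (suc (suc (suc (suc _)))) = 4F

squash-section : ∀ {m} (a : Fin 5) → squash {m} (a ↑ˡ m) ≡ a
squash-section 0F = refl
squash-section 1F = refl
squash-section 2F = refl
squash-section 3F = refl
squash-section 4F = refl

module BlownUpC₅ (m : ℕ) where

  G : Graph (5 + m)
  G = pullback C₅ squash

  diameter-G : Diameter≤2 G
  diameter-G = pullback-diameter≤2 C₅ squash squash-section C₅-near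

  diameter-Ḡ : Diameter≤2 (complement G)
  diameter-Ḡ = complement-pullback-diameter≤2 C₅ squash squash-section complement-C₅-diameter≤2

  connected-G : Connected G
  connected-G = diameter≤2⇒connected {G = G} diameter-G

  connected-Ḡ : Connected (complement G)
  connected-Ḡ = diameter≤2⇒connected {G = complement G} diameter-Ḡ

  3≤order : 3 ≤ 5 + m
  3≤order = s≤s (s≤s (s≤s z≤n))

  rvx3-G : Rvx3 G 1
  rvx3-G = rvx3≡1 {G = G} (complement G) connected-Ḡ 3≤order (complement-edge⇒¬edge {G = G}) diameter-G
    (pullback-dominated C₅ squash squash-section C₅-independent-dominated)

  rvx3-Ḡ : Rvx3 (complement G) 1
  rvx3-Ḡ = rvx3≡1 {G = complement G} G connected-G 3≤order (edge⇒¬complement-edge {G = G}) diameter-Ḡ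
    (complement-of-triangle-free {G = G} λ x y z → C₅-triangle-free (squash x) (squash y) (squash z))

lemma2p1 : ((n : ℕ) → 5 ≤ n → (G : Graph n) → Connected G → Connected (complement G) →
               (a b : ℕ) → Rvx3 G a → Rvx3 (complement G) b → 2 ≤ a + b)
             × ((n : ℕ) → 5 ≤ n → Σ (Graph n) (λ G → Connected G × Connected (complement G) ×
               Σ ℕ (λ a → Σ ℕ (λ b → Rvx3 G a × Rvx3 (complement G) b × a + b ≡ 2))))
lemma2p1 = lower-bound , sharpness
  where
  lower-bound : (n : ℕ) → 5 ≤ n → (G : Graph n) → Connected G → Connected (complement G) →
                (a b : ℕ) → Rvx3 G a → Rvx3 (complement G) b → 2 ≤ a + b
  lower-bound n 5≤n G connected co-connected a b rvx3-G rvx3-Ḡ =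
    +-mono-≤ (rvx3-positive (complement G) co-connected 3≤n (complement-edge⇒¬edge {G = G}) rvx3-G)
             (rvx3-positive G connected 3≤n (edge⇒¬complement-edge {G = G}) rvx3-Ḡ)
    where
    3≤n : 3 ≤ n
    3≤n = ≤-trans (s≤s (s≤s (s≤s z≤n))) 5≤n

  sharpness : (n : ℕ) → 5 ≤ n → Σ (Graph n) (λ G → Connected G × Connected (complement G) ×
              Σ ℕ (λ a → Σ ℕ (λ b → Rvx3 G a × Rvx3 (complement G) b × a + b ≡ 2)))
  sharpness .(5 + m) (s≤s (s≤s (s≤s (s≤s (s≤s {n = m} z≤n))))) =
    G , connected-G , connected-Ḡ , 1 , 1 , rvx3-G , rvx3-Ḡ , refl
    where open BlownUpC₅ m
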